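{- Let $\Gamma$ be an oriented graph square, and let $e \in E(\Gamma)$ be an edge contained in no copy of $K_3$ in $\Gamma$. Then in every partial orientation $G$ of $\Gamma$ as a quasi-transitive mixed graph: (1) $e$ is oriented as an arc; (2) each end of $e$ is a source or a sink of $G$; and (3) the undirected graph formed by the set of edges of $\Gamma$ contained in no copy of $K_3$ in $\Gamma$ contains no odd cycle.
   Context: A mixed graph has a vertex set, a set of (undirected) edges and a set of arcs, with at most one edge or arc between any pair of vertices; an oriented graph is a mixed graph with no edges. A partial orientation of a graph $\Gamma$ is a mixed graph obtained from $\Gamma$ by orienting some of its edges as arcs. $U(H)$ is the simple graph underlying a mixed graph $H$. For an oriented graph $\overrightarrow{G}$, $\overrightarrow{G}^2$ is obtained by adding an undirected edge between every pair of vertices at directed distance two; $\Gamma$ is an oriented graph square if $\Gamma = U(\overrightarrow{G}^2)$ for some oriented graph $\overrightarrow{G}$. A $2$-dipath is a directed path $uvw$ consisting of arcs $u\to v$, $v\to w$; it is induced if $u$ and $w$ are not joined by an edge or arc. A mixed graph $H$ is quasi-transitive when (1) it has no induced $2$-dipath and (2) for every edge $uv$ there is $w$ with $uwv$ or $vwu$ a $2$-dipath. A vertex $v$ of a mixed graph is a source (resp. sink) if every arc incident with $v$ has its tail (resp. head) at $v$ (edges incident with $v$ are ignored). The graph formed from a set $X$ of edges has as vertices the endpoints of edges in $X$ and edge set $X$. -}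

module Defs where

open import Level using (0ℓ)
open import Data.Nat using (ℕ; suc; _+_)
open import Data.Fin using (Fin; zero; suc; inject₁; fromℕ)
open import Data.Product using (Σ; ∃; ∃-syntax; _×_; _,_)
open import Data.Sum using (_⊎_)
open import Data.Empty using (⊥)
open import Relation.Nullary using (¬_)
open import Relation.Binary.PropositionalEquality using (_≡_)
open import Function using (_⇔_)
open import Function.Definitions using (Injective)

record Graph (n : ℕ) : Set₁ where
  field
    Adj     : Fin n → Fin n → Set
    sym     : ∀ {u v} → Adj u v → Adj v u
    irrefl  : ∀ {u} → ¬ Adj u u
open Graph public

record MixedGraph (n : ℕ) : Set₁ where
  field
    Arc         : Fin n → Fin n → Set
    Edge        : Fin n → Fin n → Set
    Edge-sym    : ∀ {u v} → Edge u v → Edge v u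
    Edge-irrefl : ∀ {u} → ¬ Edge u u
    Arc-irrefl  : ∀ {u} → ¬ Arc u u
    Arc-antisym : ∀ {u v} → Arc u v → Arc v u → ⊥
    Edge-Arc    : ∀ {u v} → Edge u v → Arc u v → ⊥
open MixedGraph public

IsOriented : ∀ {n} → MixedGraph n → Set
IsOriented G = ∀ u v → ¬ Edge G u v

-- Adjacency in U(G^2) for an oriented graph G: joined by an arc, or at
-- directed distance two (a 2-dipath between them in either direction).
SquareAdj : ∀ {n} → MixedGraph n → Fin n → Fin n → Set
SquareAdj G u v =
  ¬ (u ≡ v) ×
  (Arc G u v ⊎ Arc G v u ⊎
   (∃[ w ] (Arc G u w × Arc G w v)) ⊎ (∃[ w ] (Arc G v w × Arc G w u)))

IsOrientedGraphSquare : ∀ {n} → Graph n → Set₁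
IsOrientedGraphSquare {n} Γ =
  Σ (MixedGraph n) λ G → IsOriented G × (∀ u v → (Adj Γ u v ⇔ SquareAdj G u v))

IsPartialOrientation : ∀ {n} → Graph n → MixedGraph n → Set
IsPartialOrientation Γ G =
  ∀ u v → (Adj Γ u v ⇔ (Edge G u v ⊎ Arc G u v ⊎ Arc G v u))

Joined : ∀ {n} → MixedGraph n → Fin n → Fin n → Set
Joined G u v = Edge G u v ⊎ Arc G u v ⊎ Arc G v u

QuasiTransitive : ∀ {n} → MixedGraph n → Set
QuasiTransitive G =
  (∀ u v w → Arc G u v → Arc G v w → Joined G u w) ×
  (∀ u v → Edge G u v → ∃[ w ] ((Arc G u w × Arc G w v) ⊎ (Arc G v w × Arc G w u)))

IsSource : ∀ {n} → MixedGraph n → Fin n → Set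
IsSource G v = ∀ w → ¬ Arc G w v

IsSink : ∀ {n} → MixedGraph n → Fin n → Set
IsSink G v = ∀ w → ¬ Arc G v w

InNoTriangle : ∀ {n} → Graph n → Fin n → Fin n → Set
InNoTriangle Γ u v = ¬ (∃[ w ] (Adj Γ u w × Adj Γ v w))

TriangleFreeEdge : ∀ {n} → Graph n → Fin n → Fin n → Set
TriangleFreeEdge Γ u v = Adj Γ u v × InNoTriangle Γ u v

-- A relation R (an undirected graph given by its edge relation) contains an
-- odd cycle: distinct vertices f 0, ..., f (2m+2) (length 2m+3 ≥ 3) with
-- consecutive ones adjacent and the last adjacent to the first.
HasOddCycle : ∀ {n} → (Fin n → Fin n → Set) → Set
HasOddCycle {n} R =
  ∃[ m ] Σ (Fin (suc (suc (suc (m + m)))) → Fin n) λ f →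
    Injective _≡_ _≡_ f ×
    (∀ (i : Fin (suc (suc (m + m)))) → R (f (inject₁ i)) (f (suc i))) ×
    R (f (fromℕ (suc (suc (m + m))))) (f zero)

-- A triangle-free edge xy of Γ cannot be an edge of the quasi-transitive
-- partial orientation G: the 2-dipath between x and y that quasi-transitivity
-- provides would pass through a common neighbour. So xy is an arc, say x → y,
-- and any arc w → x or y → w would form a 2-dipath whose ends quasi-transitivity
-- joins, again closing a triangle. Hence every triangle-free edge is an arc
-- from a source to a sink; since no such vertex is both, colouring sources and
-- sinks properly 2-colours the triangle-free edges, which rules out odd cycles.
module Submission where

open import Defs
open import Data.Nat using (zero; suc; _+_)
open import Data.Nat.Properties using (+-suc)
open import Data.Nat.GeneralisedArithmetic using (iterate)
open import Data.Fin using (Fin; zero; suc; inject₁; fromℕ)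
open import Data.Bool using (Bool; true; false; not)
open import Data.Bool.Properties using (not-involutive)
open import Data.Product using (Σ; _×_; _,_; proj₁; proj₂)
open import Data.Sum using (_⊎_; inj₁; inj₂)
open import Data.Empty using (⊥-elim)
open import Relation.Nullary using (¬_)
open import Relation.Binary.PropositionalEquality using (_≡_; refl; subst; trans)
open import Function.Bundles using (Equivalence)

iterate-not-even : ∀ m b → iterate not b (m + m) ≡ b
iterate-not-even zero    b = refl
iterate-not-even (suc m) b rewrite +-suc m m | not-involutive b = iterate-not-even m b

module _ {n} (Γ : Graph n) where

  InNoTriangle-sym : ∀ {u v} → InNoTriangle Γ u v → InNoTriangle Γ v u
  InNoTriangle-sym nt (w , vw , uw) = nt (w , uw , vw)

  TriangleFreeEdge-sym : ∀ {u v} → TriangleFreeEdge Γ u v → TriangleFreeEdge Γ v u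
  TriangleFreeEdge-sym (adj , nt) = sym Γ adj , InNoTriangle-sym nt

module QuasiTransitiveOrientation {n} (Γ : Graph n) (G : MixedGraph n)
         (P : IsPartialOrientation Γ G) (Q : QuasiTransitive G) where

  private
    Joined⇒Adj : ∀ {u v} → Joined G u v → Adj Γ u v
    Joined⇒Adj {u} {v} = Equivalence.from (P u v)

    arc⇒Adj : ∀ {u v} → Arc G u v → Adj Γ u v
    arc⇒Adj a = Joined⇒Adj (inj₂ (inj₁ a))

    arc⇒Adjᵒ : ∀ {u v} → Arc G v u → Adj Γ u v
    arc⇒Adjᵒ a = Joined⇒Adj (inj₂ (inj₂ a))

    dipath⇒Adj : ∀ {u v w} → Arc G u v → Arc G v w → Adj Γ u w
    dipath⇒Adj {u} {v} {w} uv vw = Joined⇒Adj (proj₁ Q u v w uv vw)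

  inNoTriangle⇒arc : ∀ {x y} → Adj Γ x y → InNoTriangle Γ x y →
                     Arc G x y ⊎ Arc G y x
  inNoTriangle⇒arc {x} {y} adj nt with Equivalence.to (P x y) adj
  ... | inj₂ arc = arc
  ... | inj₁ e with proj₂ Q x y e
  ... | w , inj₁ (xw , wy) = ⊥-elim (nt (w , arc⇒Adj xw , arc⇒Adjᵒ wy))
  ... | w , inj₂ (yw , wx) = ⊥-elim (nt (w , arc⇒Adjᵒ wx , arc⇒Adj yw))

  arc-inNoTriangle⇒source : ∀ {x y} → InNoTriangle Γ x y → Arc G x y → IsSource G x
  arc-inNoTriangle⇒source nt xy w wx =
    nt (w , arc⇒Adjᵒ wx , sym Γ (dipath⇒Adj wx xy))

  arc-inNoTriangle⇒sink : ∀ {x y} → InNoTriangle Γ x y → Arc G x y → IsSink G y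
  arc-inNoTriangle⇒sink nt xy w yw = nt (w , dipath⇒Adj xy yw , arc⇒Adj yw)

  triangleFreeEdge⇒source⊎sink : ∀ {u v} → TriangleFreeEdge Γ u v →
                                 IsSource G u ⊎ IsSink G u
  triangleFreeEdge⇒source⊎sink (adj , nt) with inNoTriangle⇒arc adj nt
  ... | inj₁ uv = inj₁ (arc-inNoTriangle⇒source nt uv)
  ... | inj₂ vu = inj₂ (arc-inNoTriangle⇒sink (InNoTriangle-sym Γ nt) vu)

  Side : Bool → Fin n → Set
  Side true  = IsSource G
  Side false = IsSink G

  triangleFreeEdge-alternates : ∀ {u v} b → TriangleFreeEdge Γ u v →
                                Side b u → Side (not b) v
  triangleFreeEdge-alternates {v = v} b (adj , nt) side
    with b | inNoTriangle⇒arc adj nt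
  ... | true  | inj₁ uv = arc-inNoTriangle⇒sink nt uv
  ... | true  | inj₂ vu = ⊥-elim (side v vu)
  ... | false | inj₁ uv = ⊥-elim (side v uv)
  ... | false | inj₂ vu = arc-inNoTriangle⇒source (InNoTriangle-sym Γ nt) vu

  triangleFreeEdge-sides-disjoint : ∀ {u v} b → TriangleFreeEdge Γ u v →
                                    Side b v → ¬ Side (not b) v
  triangleFreeEdge-sides-disjoint {u} b (adj , nt) side side′
    with b | inNoTriangle⇒arc adj nt
  ... | true  | inj₁ uv = side u uv
  ... | true  | inj₂ vu = side′ u vu
  ... | false | inj₁ uv = side′ u uv
  ... | false | inj₂ vu = side u vu

  walk-alternates : ∀ L (f : Fin (suc L) → Fin n) →
                    (∀ (i : Fin L) → TriangleFreeEdge Γ (f (inject₁ i)) (f (suc i))) →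
                    ∀ b → Side b (f zero) → Side (iterate not b L) (f (fromℕ L))
  walk-alternates zero    f edges b side = side
  walk-alternates (suc L) f edges b side =
    walk-alternates L (λ i → f (suc i)) (λ i → edges (suc i)) (not b)
      (triangleFreeEdge-alternates b (edges zero) side)

  no-odd-triangleFreeCycle : ¬ HasOddCycle (TriangleFreeEdge Γ)
  no-odd-triangleFreeCycle (m , f , _ , edges , closing) =
    triangleFreeEdge-sides-disjoint b closing side₀
      (triangleFreeEdge-alternates b closing sideₗₐₛₜ)
    where
    start : Σ Bool λ b → Side b (f zero)
    start with triangleFreeEdge⇒source⊎sink (edges zero)
    ... | inj₁ source = true  , source
    ... | inj₂ sink   = false , sink

    b : Bool
    b = proj₁ start

    side₀ : Side b (f zero)
    side₀ = proj₂ start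

    sideₗₐₛₜ : Side b (f (fromℕ (suc (suc (m + m)))))
    sideₗₐₛₜ = subst (λ c → Side c _)
      (trans (iterate-not-even m (not (not b))) (not-involutive b))
      (walk-alternates _ f edges b side₀)

lemma2p2 : ∀ {n} (Γ : Graph n) → IsOrientedGraphSquare Γ →
    ∀ (x y : Fin n) → Adj Γ x y → InNoTriangle Γ x y →
    ∀ (G : MixedGraph n) → IsPartialOrientation Γ G → QuasiTransitive G →
    ((Arc G x y ⊎ Arc G y x) ×
     ((IsSource G x ⊎ IsSink G x) × (IsSource G y ⊎ IsSink G y)) ×
     ¬ HasOddCycle (TriangleFreeEdge Γ))
lemma2p2 Γ _ x y adj nt G P Q =
  inNoTriangle⇒arc adj nt ,
  (triangleFreeEdge⇒source⊎sink xy ,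
   triangleFreeEdge⇒source⊎sink (TriangleFreeEdge-sym Γ xy)) ,
  no-odd-triangleFreeCycle
  where
  open QuasiTransitiveOrientation Γ G P Q

  xy : TriangleFreeEdge Γ x y
  xy = adj , nt
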